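{- Let $a,b,m$ be parameters with $m\neq0$. The power series $$\frac{1+ax}{1+bx}\;c\!\left(\frac{mx(1+ax)}{(1+bx)^2}\right)$$ is the generating function of the sequence $(a_n)_{n\ge0}$ defined by $a_0=1$, $a_1=a-b+m$ and, for $n\ge2$, $$a_n=(-b+2m)\,a_{n-1}+m\sum_{k=0}^{n-3}a_{k+1}a_{n-k-2}.$$
   Context: $c(x)=\frac{1-\sqrt{1-4x}}{2x}=\sum_{n\ge0}C_nx^n$ is the generating function of the Catalan numbers $C_n=\frac{1}{n+1}\binom{2n}{n}$. -}

module Defs where

open import Level using (Level)
open import Algebra.Bundles using (CommutativeRing)
open import Data.Nat as ℕ using (ℕ; zero; suc; _∸_)
open import Data.Nat.Combinatorics using (_C_)
open import Data.Nat.DivMod using (_/_)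

-- Catalan numbers  C_n = (1/(n+1)) * binom(2n, n)   (exact division in ℕ)
catalan : ℕ → ℕ
catalan n = ((2 ℕ.* n) C n) / suc n

module Series {c ℓ : Level} (R : CommutativeRing c ℓ) where
  open CommutativeRing R

  FPS : Set c
  FPS = ℕ → Carrier

  fromℕ : ℕ → Carrier
  fromℕ zero = 0#
  fromℕ (suc n) = 1# + fromℕ n

  _^_ : Carrier → ℕ → Carrier
  x ^ zero = 1#
  x ^ suc n = x * (x ^ n)

  sumTo : ℕ → (ℕ → Carrier) → Carrier
  sumTo zero f = 0#
  sumTo (suc n) f = sumTo n f + f n

  one : FPS
  one zero = 1#
  one (suc n) = 0#

  onePlus : Carrier → FPS
  onePlus t zero = 1#
  onePlus t (suc zero) = t
  onePlus t (suc (suc n)) = 0#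

  X : FPS
  X zero = 0#
  X (suc zero) = 1#
  X (suc (suc n)) = 0#

  scale : Carrier → FPS → FPS
  scale t f n = t * f n

  mul : FPS → FPS → FPS
  mul f g n = sumTo (suc n) (λ k → f k * g (n ∸ k))

  pow : FPS → ℕ → FPS
  pow f zero = one
  pow f (suc k) = mul f (pow f k)

  -- the multiplicative inverse of 1 + t x in R[[x]], namely Σ_n (-t)^n x^n
  invOnePlus : Carrier → FPS
  invOnePlus t n = (- t) ^ n

  -- composition  f(g(x)),  meaningful for g with zero constant term:
  -- [x^n] f(g) = Σ_{k ≤ n} f_k [x^n] g^k
  comp : FPS → FPS → FPS
  comp f g n = sumTo (suc n) (λ k → f k * pow g k n)

  catalanGF : FPS
  catalanGF n = fromℕ (catalan n)

  theSeries : Carrier → Carrier → Carrier → FPS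
  theSeries a b m =
    mul (mul (onePlus a) (invOnePlus b))
        (comp catalanGF
              (scale m (mul X (mul (onePlus a) (mul (invOnePlus b) (invOnePlus b))))))

module Submission where

-- Let  A = 1 + ax,  I = (1 + bx)⁻¹,  g = m x A I²  and  F = A I c(g).  Since the
-- Catalan series satisfies  c = 1 + x c²,  composing gives  c(g) = 1 + g c(g)²,  and
-- multiplying by  A  yields the functional equation  (1 + bx) F = A + m x F².
-- Comparing coefficients of this equation gives exactly  F₀ = 1,  F₁ = a - b + m
-- and the stated recurrence, which determines a sequence uniquely.

open import Level using (Level)
open import Algebra.Bundles using (CommutativeRing)
open import Algebra.Structures using (IsCommutativeRing)
open import Data.Nat as ℕ using (ℕ; zero; suc; _∸_; _≤_; _<_; s≤s)
import Data.Nat.Properties as ℕP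
open import Data.Product using (_,_)
open import Data.Sum using (inj₁; inj₂)
open import Function using (_∘_)
open import Relation.Binary.PropositionalEquality as ≡ using (_≡_)
open import Relation.Nullary using (¬_)
open import Defs

module FiniteSums {c ℓ : Level} (R : CommutativeRing c ℓ) where
  open CommutativeRing R
  open Series R using (sumTo)
  open import Algebra.Properties.CommutativeSemigroup +-commutativeSemigroup
    using (interchange)
  open import Relation.Binary.Reasoning.Setoid setoid

  sumTo-cong< : ∀ n {f g : ℕ → Carrier} → (∀ k → k < n → f k ≈ g k) →
                sumTo n f ≈ sumTo n g
  sumTo-cong< zero    f≈g = refl
  sumTo-cong< (suc n) f≈g =
    +-cong (sumTo-cong< n (λ k k<n → f≈g k (ℕP.m<n⇒m<1+n k<n))) (f≈g n ℕP.≤-refl)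

  sumTo-cong : ∀ n {f g : ℕ → Carrier} → (∀ k → f k ≈ g k) → sumTo n f ≈ sumTo n g
  sumTo-cong n f≈g = sumTo-cong< n (λ k _ → f≈g k)

  sumTo-+ : ∀ n (f g : ℕ → Carrier) →
            sumTo n (λ k → f k + g k) ≈ sumTo n f + sumTo n g
  sumTo-+ zero    f g = sym (+-identityˡ 0#)
  sumTo-+ (suc n) f g = trans (+-congʳ (sumTo-+ n f g)) (interchange _ _ _ _)

  sumTo-*ˡ : ∀ n x (f : ℕ → Carrier) → sumTo n (λ k → x * f k) ≈ x * sumTo n f
  sumTo-*ˡ zero    x f = sym (zeroʳ x)
  sumTo-*ˡ (suc n) x f = trans (+-congʳ (sumTo-*ˡ n x f)) (sym (distribˡ x _ _))

  sumTo-*ʳ : ∀ n x (f : ℕ → Carrier) → sumTo n (λ k → f k * x) ≈ sumTo n f * x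
  sumTo-*ʳ zero    x f = sym (zeroˡ x)
  sumTo-*ʳ (suc n) x f = trans (+-congʳ (sumTo-*ʳ n x f)) (sym (distribʳ x _ _))

  sumTo-zero : ∀ n (f : ℕ → Carrier) → (∀ k → k < n → f k ≈ 0#) → sumTo n f ≈ 0#
  sumTo-zero zero    f f≈0 = refl
  sumTo-zero (suc n) f f≈0 =
    trans (+-cong (sumTo-zero n f (λ k k<n → f≈0 k (ℕP.m<n⇒m<1+n k<n))) (f≈0 n ℕP.≤-refl))
          (+-identityʳ 0#)

  sumTo-head : ∀ n (f : ℕ → Carrier) → sumTo (suc n) f ≈ f 0 + sumTo n (f ∘ suc)
  sumTo-head zero    f = trans (+-identityˡ _) (sym (+-identityʳ _))
  sumTo-head (suc n) f = trans (+-congʳ (sumTo-head n f)) (+-assoc _ _ _)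

  sumTo-pad : ∀ n N (f : ℕ → Carrier) → (∀ k → n ≤ k → f k ≈ 0#) → n ≤ N →
              sumTo N f ≈ sumTo n f
  sumTo-pad n N f f≈0 n≤N with ℕP.m≤n⇒m<n∨m≡n n≤N
  ... | inj₂ ≡.refl = refl
  sumTo-pad n (suc N) f f≈0 _ | inj₁ (s≤s n≤N) =
    trans (+-cong (sumTo-pad n N f f≈0 n≤N) (f≈0 N n≤N)) (+-identityʳ _)

  sumTo-swap : ∀ n m (F : ℕ → ℕ → Carrier) →
    sumTo n (λ i → sumTo m (F i)) ≈ sumTo m (λ j → sumTo n (λ i → F i j))
  sumTo-swap zero    m F = sym (sumTo-zero m _ (λ _ _ → refl))
  sumTo-swap (suc n) m F =
    trans (+-congʳ (sumTo-swap n m F)) (sym (sumTo-+ m _ (F n)))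

  sumTo-reverse : ∀ n (f : ℕ → Carrier) → sumTo n f ≈ sumTo n (λ k → f (n ∸ suc k))
  sumTo-reverse zero    f = refl
  sumTo-reverse (suc n) f = begin
    sumTo n f + f n                       ≈⟨ +-comm _ _ ⟩
    f n + sumTo n f                       ≈⟨ +-congˡ (sumTo-reverse n f) ⟩
    f n + sumTo n (λ k → f (n ∸ suc k))   ≈⟨ sumTo-head n (λ k → f (n ∸ k)) ⟨
    sumTo (suc n) (λ k → f (n ∸ k))       ∎

  sumTo-triangle : ∀ n (F : ℕ → ℕ → Carrier) →
    sumTo (suc n) (λ k → sumTo (suc k) (λ i → F i k)) ≈
    sumTo (suc n) (λ i → sumTo (suc (n ∸ i)) (λ j → F i (i ℕ.+ j)))
  sumTo-triangle zero    F = refl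
  sumTo-triangle (suc n) F = begin
    sumTo (suc n) (λ k → sumTo (suc k) (λ i → F i k)) + (column + F (suc n) (suc n))
      ≈⟨ +-congʳ (sumTo-triangle n F) ⟩
    sumTo (suc n) rows + (column + F (suc n) (suc n))
      ≈⟨ +-assoc _ _ _ ⟨
    (sumTo (suc n) rows + column) + F (suc n) (suc n)
      ≈⟨ +-cong (sumTo-+ (suc n) rows (λ i → F i (suc n))) corner ⟨
    sumTo (suc n) (λ i → rows i + F i (suc n)) + sumTo (suc (n ∸ n)) (λ j → F (suc n) (suc n ℕ.+ j))
      ≈⟨ +-congʳ (sumTo-cong< (suc n) (λ i i<1+n → extend-row i (ℕP.≤-pred i<1+n))) ⟩
    sumTo (suc n) (λ i → sumTo (suc (suc n ∸ i)) (λ j → F i (i ℕ.+ j)))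
      + sumTo (suc (n ∸ n)) (λ j → F (suc n) (suc n ℕ.+ j)) ∎
    where
    rows : ℕ → Carrier
    rows i = sumTo (suc (n ∸ i)) (λ j → F i (i ℕ.+ j))
    column : Carrier
    column = sumTo (suc n) (λ i → F i (suc n))
    corner : sumTo (suc (n ∸ n)) (λ j → F (suc n) (suc n ℕ.+ j)) ≈ F (suc n) (suc n)
    corner rewrite ℕP.n∸n≡0 n | ℕP.+-identityʳ n = +-identityˡ _
    extend-row : ∀ i → i ≤ n →
      rows i + F i (suc n) ≈ sumTo (suc (suc n ∸ i)) (λ j → F i (i ℕ.+ j))
    extend-row i i≤n rewrite ℕP.+-∸-assoc 1 i≤n =
      +-congˡ (reflexive (≡.cong (F i) (≡.sym (≡.trans (ℕP.+-suc i (n ∸ i))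
                                                       (≡.cong suc (ℕP.m+[n∸m]≡n i≤n))))))

module NatEmbedding {c ℓ : Level} (R : CommutativeRing c ℓ) where
  open CommutativeRing R
  open Series R using (fromℕ)

  fromℕ-+ : ∀ m n → fromℕ (m ℕ.+ n) ≈ fromℕ m + fromℕ n
  fromℕ-+ zero    n = sym (+-identityˡ _)
  fromℕ-+ (suc m) n = trans (+-congˡ (fromℕ-+ m n)) (sym (+-assoc _ _ _))

  fromℕ-* : ∀ m n → fromℕ (m ℕ.* n) ≈ fromℕ m * fromℕ n
  fromℕ-* zero    n = sym (zeroˡ _)
  fromℕ-* (suc m) n =
    trans (fromℕ-+ n (m ℕ.* n))
          (trans (+-cong (sym (*-identityˡ _)) (fromℕ-* m n)) (sym (distribʳ _ _ _)))

module PowerSeries {c ℓ : Level} (R : CommutativeRing c ℓ) where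
  open CommutativeRing R
  open Series R
  open FiniteSums R
  open import Relation.Binary.Reasoning.Setoid setoid

  infix 4 _≈ₛ_
  _≈ₛ_ : FPS → FPS → Set ℓ
  f ≈ₛ g = ∀ n → f n ≈ g n

  add : FPS → FPS → FPS
  add f g n = f n + g n

  neg : FPS → FPS
  neg f n = - f n

  zeroₛ : FPS
  zeroₛ n = 0#

  -- The ring laws of the Cauchy product; associativity is Fubini on a triangle.
  mul-cong : ∀ {f f′ g g′} → f ≈ₛ f′ → g ≈ₛ g′ → mul f g ≈ₛ mul f′ g′
  mul-cong f≈f′ g≈g′ n = sumTo-cong (suc n) (λ k → *-cong (f≈f′ k) (g≈g′ (n ∸ k)))

  mul-comm : ∀ f g → mul f g ≈ₛ mul g f
  mul-comm f g n = begin
    sumTo (suc n) (λ k → f k * g (n ∸ k))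
      ≈⟨ sumTo-reverse (suc n) _ ⟩
    sumTo (suc n) (λ k → f (n ∸ k) * g (n ∸ (n ∸ k)))
      ≈⟨ sumTo-cong< (suc n) (λ k k<1+n → trans (*-comm _ _)
           (*-congʳ (reflexive (≡.cong g (ℕP.m∸[m∸n]≡n (ℕP.≤-pred k<1+n)))))) ⟩
    sumTo (suc n) (λ k → g k * f (n ∸ k)) ∎

  mul-assoc : ∀ f g h → mul (mul f g) h ≈ₛ mul f (mul g h)
  mul-assoc f g h n = begin
    sumTo (suc n) (λ k → sumTo (suc k) (λ i → f i * g (k ∸ i)) * h (n ∸ k))
      ≈⟨ sumTo-cong (suc n) (λ k → sumTo-*ʳ (suc k) _ _) ⟨
    sumTo (suc n) (λ k → sumTo (suc k) (λ i → f i * g (k ∸ i) * h (n ∸ k)))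
      ≈⟨ sumTo-triangle n (λ i k → f i * g (k ∸ i) * h (n ∸ k)) ⟩
    sumTo (suc n) (λ i → sumTo (suc (n ∸ i)) (λ j → f i * g (i ℕ.+ j ∸ i) * h (n ∸ (i ℕ.+ j))))
      ≈⟨ sumTo-cong (suc n) (λ i → sumTo-cong (suc (n ∸ i)) (λ j →
           trans (*-assoc _ _ _) (*-congˡ (*-cong (reflexive (≡.cong g (ℕP.m+n∸m≡n i j)))
                                                  (reflexive (≡.cong h (≡.sym (ℕP.∸-+-assoc n i j)))))))) ⟩
    sumTo (suc n) (λ i → sumTo (suc (n ∸ i)) (λ j → f i * (g j * h (n ∸ i ∸ j))))
      ≈⟨ sumTo-cong (suc n) (λ i → sumTo-*ˡ (suc (n ∸ i)) (f i) _) ⟩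
    sumTo (suc n) (λ i → f i * sumTo (suc (n ∸ i)) (λ j → g j * h (n ∸ i ∸ j))) ∎

  mul-identityˡ : ∀ f → mul one f ≈ₛ f
  mul-identityˡ f n = begin
    sumTo (suc n) (λ k → one k * f (n ∸ k))                   ≈⟨ sumTo-head n _ ⟩
    1# * f n + sumTo n (λ k → 0# * f (n ∸ suc k))             ≈⟨ +-cong (*-identityˡ _) (sumTo-zero n _ (λ k _ → zeroˡ _)) ⟩
    f n + 0#                                                  ≈⟨ +-identityʳ _ ⟩
    f n                                                       ∎

  mul-distribˡ : ∀ f g h → mul f (add g h) ≈ₛ add (mul f g) (mul f h)
  mul-distribˡ f g h n =
    trans (sumTo-cong (suc n) (λ k → distribˡ (f k) _ _)) (sumTo-+ (suc n) _ _)

  powerSeries-isCommutativeRing : IsCommutativeRing _≈ₛ_ add mul neg zeroₛ one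
  powerSeries-isCommutativeRing = record
    { isRing = record
      { +-isAbelianGroup = record
        { isGroup = record
          { isMonoid = record
            { isSemigroup = record
              { isMagma = record
                { isEquivalence = record
                  { refl = λ n → refl ; sym = λ e n → sym (e n) ; trans = λ e e′ n → trans (e n) (e′ n) }
                ; ∙-cong = λ e e′ n → +-cong (e n) (e′ n) }
              ; assoc = λ f g h n → +-assoc (f n) (g n) (h n) }
            ; identity = (λ f n → +-identityˡ (f n)) , (λ f n → +-identityʳ (f n)) }
          ; inverse = (λ f n → -‿inverseˡ (f n)) , (λ f n → -‿inverseʳ (f n))
          ; ⁻¹-cong = λ e n → -‿cong (e n) }
        ; comm = λ f g n → +-comm (f n) (g n) }
      ; *-cong = mul-cong
      ; *-assoc = mul-assoc
      ; *-identity = mul-identityˡ , (λ f n → trans (mul-comm f one n) (mul-identityˡ f n))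
      ; distrib = mul-distribˡ
                , (λ f g h n → trans (mul-comm (add g h) f n)
                                 (trans (mul-distribˡ f g h n) (+-cong (mul-comm f g n) (mul-comm f h n)))) }
    ; *-comm = mul-comm }

  powerSeriesRing : CommutativeRing c ℓ
  powerSeriesRing = record { isCommutativeRing = powerSeries-isCommutativeRing }

  const : Carrier → FPS
  const t n = t * one n

  mul-const : ∀ t f → mul (const t) f ≈ₛ scale t f
  mul-const t f n = begin
    sumTo (suc n) (λ k → t * one k * f (n ∸ k))    ≈⟨ sumTo-cong (suc n) (λ k → *-assoc _ _ _) ⟩
    sumTo (suc n) (λ k → t * (one k * f (n ∸ k)))  ≈⟨ sumTo-*ˡ (suc n) t _ ⟩
    t * mul one f n                                ≈⟨ *-congˡ (mul-identityˡ f n) ⟩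
    t * f n                                        ∎

  X-mul-zero : ∀ f → mul X f 0 ≈ 0#
  X-mul-zero f = trans (+-identityˡ _) (zeroˡ _)

  X-mul-suc : ∀ f n → mul X f (suc n) ≈ f n
  X-mul-suc f n = begin
    mul X f (suc n)                                                ≈⟨ sumTo-head (suc n) _ ⟩
    0# * f (suc n) + sumTo (suc n) (λ k → X (suc k) * f (n ∸ k))    ≈⟨ +-cong (zeroˡ _) (sumTo-head n _) ⟩
    0# + (1# * f n + sumTo n (λ k → 0# * f (n ∸ suc k)))           ≈⟨ +-identityˡ _ ⟩
    1# * f n + sumTo n (λ k → 0# * f (n ∸ suc k))                  ≈⟨ +-cong (*-identityˡ _) (sumTo-zero n _ (λ _ _ → zeroˡ _)) ⟩
    f n + 0#                                                       ≈⟨ +-identityʳ _ ⟩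
    f n                                                            ∎

  onePlus-mul-zero : ∀ t f → mul (onePlus t) f 0 ≈ f 0
  onePlus-mul-zero t f = trans (+-identityˡ _) (*-identityˡ _)

  onePlus-mul-suc : ∀ t f n → mul (onePlus t) f (suc n) ≈ f (suc n) + t * f n
  onePlus-mul-suc t f n = begin
    mul (onePlus t) f (suc n)
      ≈⟨ sumTo-head (suc n) _ ⟩
    1# * f (suc n) + sumTo (suc n) (λ k → onePlus t (suc k) * f (n ∸ k))
      ≈⟨ +-cong (*-identityˡ _) (sumTo-head n _) ⟩
    f (suc n) + (t * f n + sumTo n (λ k → 0# * f (n ∸ suc k)))
      ≈⟨ +-congˡ (trans (+-congˡ (sumTo-zero n _ (λ _ _ → zeroˡ _))) (+-identityʳ _)) ⟩
    f (suc n) + t * f n ∎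

  onePlus-inverse : ∀ t → mul (onePlus t) (invOnePlus t) ≈ₛ one
  onePlus-inverse t zero    = onePlus-mul-zero t (invOnePlus t)
  onePlus-inverse t (suc n) = begin
    mul (onePlus t) (invOnePlus t) (suc n)  ≈⟨ onePlus-mul-suc t (invOnePlus t) n ⟩
    (- t) * (- t) ^ n + t * (- t) ^ n       ≈⟨ distribʳ _ _ _ ⟨
    ((- t) + t) * (- t) ^ n                 ≈⟨ *-congʳ (-‿inverseˡ t) ⟩
    0# * (- t) ^ n                          ≈⟨ zeroˡ _ ⟩
    0#                                      ∎

  mul-tail : ∀ f h → (mul f h ∘ suc) ≈ₛ add (mul (f ∘ suc) h) (scale (f 0) (h ∘ suc))
  mul-tail f h n = trans (sumTo-head (suc n) _) (+-comm _ _)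

  square-suc : ∀ f n → mul f f (suc n) ≈
    f 0 * f (suc n) + (sumTo n (λ k → f (suc k) * f (n ∸ k)) + f (suc n) * f 0)
  square-suc f n = trans (sumTo-head (suc n) _)
    (+-congˡ (+-congˡ (*-congˡ (reflexive (≡.cong f (ℕP.n∸n≡0 n))))))

-- Polynomial identities valid in every commutative ring; they are applied
-- below both to R and to the power series ring R[[x]].
module RingIdentities {c ℓ : Level} (S : CommutativeRing c ℓ) where
  open CommutativeRing S
  open Series S using (fromℕ)
  open import Algebra.Solver.Ring.NaturalCoefficients.Default commutativeSemiring
  open import Algebra.Properties.Ring ring using (-‿distribˡ-*)
  open import Algebra.Properties.Group +-group using (quasigroup)
  open import Algebra.Properties.Quasigroup quasigroup using (cancelʳ; x≈z//y)
  open import Algebra.Properties.CommutativeSemigroup +-commutativeSemigroup using (xy∙z≈xz∙y)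
  open import Relation.Binary.Reasoning.Setoid setoid

  product-expansion : ∀ a b G F H →
    (a + G * F) * (b + G * H) ≈ a * b + G * (F * (b + G * H) + a * H)
  product-expansion = solve 5 (λ a b G F H →
    (a :+ G :* F) :* (b :+ G :* H) := a :* b :+ G :* (F :* (b :+ G :* H) :+ a :* H)) refl

  -- If  G = 1 + x G²  and  Q = x G² + x (Q G + G Q)  (Q playing θG), then
  -- (1 - 4x) Q + G = 1 + 2 x G, written without subtraction.
  quadratic-ratio : ∀ x G Q → G ≈ 1# + x * (G * G) → Q ≈ x * (G * G) + x * (Q * G + G * Q) →
    Q + G ≈ 1# + ((x * G + x * G) + ((x * Q + x * Q) + (x * Q + x * Q)))
  quadratic-ratio x G Q G≈ Q≈ = cancelʳ ((α * G + Q) + d * Q) (Q + G) _ (begin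
    (Q + G) + ((α * G + Q) + d * Q)   ≈⟨ +-congˡ (+-congʳ (+-cong (*-congˡ G≈) Q≈)) ⟩
    (Q + G) + ((α * P₀ + P₁) + d * Q) ≈⟨ rearrange x G Q ⟩
    RHS + ((α * G + Q) + d * P₁)      ≈⟨ +-congˡ (+-congˡ (*-congˡ Q≈)) ⟨
    RHS + ((α * G + Q) + d * Q)       ∎)
    where
    d = x * G + x * G
    α = (1# + d) + ((x * Q + x * Q) + (x * Q + x * Q))
    P₀ = 1# + x * (G * G)
    P₁ = x * (G * G) + x * (Q * G + G * Q)
    RHS = 1# + (d + ((x * Q + x * Q) + (x * Q + x * Q)))
    rearrange : ∀ x G Q → let d = x * G + x * G
                              q = (x * Q + x * Q) + (x * Q + x * Q)
                              P₁ = x * (G * G) + x * (Q * G + G * Q)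
                          in (Q + G) + ((((1# + d) + q) * (1# + x * (G * G)) + P₁) + d * Q)
                             ≈ (1# + (d + q)) + ((((1# + d) + q) * G + Q) + d * P₁)
    rearrange = solve 3 (λ x G Q →
      let d = x :* G :+ x :* G
          q = (x :* Q :+ x :* Q) :+ (x :* Q :+ x :* Q)
          P₁ = x :* (G :* G) :+ x :* (Q :* G :+ G :* Q)
      in (Q :+ G) :+ ((((con 1 :+ d) :+ q) :* (con 1 :+ x :* (G :* G)) :+ P₁) :+ d :* Q)
         := (con 1 :+ (d :+ q)) :+ ((((con 1 :+ d) :+ q) :* G :+ Q) :+ d :* P₁)) refl

  -- The algebra behind  B F = A + m x F²  for  F = A I C  (see the main theorem).
  functional-equation : ∀ A B I C g M X → B * I ≈ 1# → C ≈ 1# + g * (C * C) →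
    g ≈ M * (X * (A * (I * I))) →
    B * ((A * I) * C) ≈ A + M * (X * (((A * I) * C) * ((A * I) * C)))
  functional-equation A B I C g M X BI≈1 C≈ g≈ = begin
    B * ((A * I) * C)                        ≈⟨ regroup A B I C ⟩
    (A * C) * (B * I)                        ≈⟨ *-congˡ BI≈1 ⟩
    (A * C) * 1#                             ≈⟨ *-identityʳ _ ⟩
    A * C                                    ≈⟨ *-congˡ (trans C≈ (+-congˡ (*-congʳ g≈))) ⟩
    A * (1# + (M * (X * (A * (I * I)))) * (C * C)) ≈⟨ expand A I C M X ⟩
    A + M * (X * (((A * I) * C) * ((A * I) * C))) ∎
    where
    regroup : ∀ A B I C → B * ((A * I) * C) ≈ (A * C) * (B * I)
    regroup = solve 4 (λ A B I C → B :* ((A :* I) :* C) := (A :* C) :* (B :* I)) refl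
    expand : ∀ A I C M X → A * (1# + (M * (X * (A * (I * I)))) * (C * C))
                           ≈ A + M * (X * (((A * I) * C) * ((A * I) * C)))
    expand = solve 5 (λ A I C M X →
      A :* (con 1 :+ (M :* (X :* (A :* (I :* I)))) :* (C :* C))
      := A :+ M :* (X :* (((A :* I) :* C) :* ((A :* I) :* C)))) refl

  solve-first : ∀ {z} a b m → z + b ≈ a + m → z ≈ a - b + m
  solve-first {z} a b m z+b≈ = trans (x≈z//y z b (a + m) z+b≈) (xy∙z≈xz∙y a m (- b))

  solve-step : ∀ {z} b m y S → z + b * y ≈ m * (y + (S + y)) →
               z ≈ ((- b) + fromℕ 2 * m) * y + m * S
  solve-step {z} b m y S z+by≈ = begin
    z                                  ≈⟨ x≈z//y z (b * y) _ z+by≈ ⟩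
    m * (y + (S + y)) - b * y          ≈⟨ +-congˡ (-‿distribˡ-* b y) ⟩
    m * (y + (S + y)) + (- b) * y      ≈⟨ collect m y S (- b) ⟩
    ((- b) + fromℕ 2 * m) * y + m * S  ∎
    where
    collect : ∀ m y S nb → m * (y + (S + y)) + nb * y ≈ (nb + fromℕ 2 * m) * y + m * S
    collect = solve 4 (λ m y S nb →
      m :* (y :+ (S :+ y)) :+ nb :* y := (nb :+ (con 1 :+ (con 1 :+ con 0)) :* m) :* y :+ m :* S) refl

module Composition {c ℓ : Level} (R : CommutativeRing c ℓ) where
  open CommutativeRing R
  open Series R
  open FiniteSums R
  open PowerSeries R
  open RingIdentities powerSeriesRing using (product-expansion)
  open import Relation.Binary.Reasoning.Setoid setoid

  mul-agree-below : ∀ g A B → g 0 ≈ 0# → ∀ j → (∀ i → i < j → A i ≈ B i) →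
                    mul g A j ≈ mul g B j
  mul-agree-below g A B g₀≈0 j A≈B = begin
    mul g A j                                               ≈⟨ sumTo-head j _ ⟩
    g 0 * A j + sumTo j (λ k → g (suc k) * A (j ∸ suc k))   ≈⟨ +-cong g₀-term (sumTo-cong< j tail) ⟩
    g 0 * B j + sumTo j (λ k → g (suc k) * B (j ∸ suc k))   ≈⟨ sumTo-head j _ ⟨
    mul g B j                                               ∎
    where
    g₀-term : g 0 * A j ≈ g 0 * B j
    g₀-term = trans (*-congʳ g₀≈0) (trans (zeroˡ _) (sym (trans (*-congʳ g₀≈0) (zeroˡ _))))
    tail : ∀ k → k < j → g (suc k) * A (j ∸ suc k) ≈ g (suc k) * B (j ∸ suc k)
    tail k (s≤s _) = *-congˡ (A≈B _ (s≤s (ℕP.m∸n≤m _ k)))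

  module _ (g : FPS) (g₀≈0 : g 0 ≈ 0#) where

    pow-vanishes : ∀ k j → j < k → pow g k j ≈ 0#
    pow-vanishes (suc k) j j<1+k = begin
      mul g (pow g k) j  ≈⟨ mul-agree-below g _ zeroₛ g₀≈0 j below ⟩
      mul g zeroₛ j      ≈⟨ sumTo-zero (suc j) _ (λ _ _ → zeroʳ _) ⟩
      0#                 ∎
      where
      below : ∀ i → i < j → pow g k i ≈ 0#
      below i i<j = pow-vanishes k i (ℕP.<-≤-trans i<j (ℕP.≤-pred j<1+k))

    comp-pad : ∀ f n N → suc n ≤ N → comp f g n ≈ sumTo N (λ k → f k * pow g k n)
    comp-pad f n N n<N = sym (sumTo-pad (suc n) N _
      (λ k n<k → trans (*-congˡ (pow-vanishes k n n<k)) (zeroʳ _)) n<N)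

    comp-cong : ∀ {f f′} → f ≈ₛ f′ → comp f g ≈ₛ comp f′ g
    comp-cong f≈f′ n = sumTo-cong (suc n) (λ k → *-congʳ (f≈f′ k))

    comp-add : ∀ f h → comp (add f h) g ≈ₛ add (comp f g) (comp h g)
    comp-add f h n = trans (sumTo-cong (suc n) (λ k → distribʳ _ _ _)) (sumTo-+ (suc n) _ _)

    comp-scale : ∀ t f → comp (scale t f) g ≈ₛ scale t (comp f g)
    comp-scale t f n = trans (sumTo-cong (suc n) (λ k → *-assoc _ _ _)) (sumTo-*ˡ (suc n) t _)

    horner : ∀ f → comp f g ≈ₛ add (const (f 0)) (mul g (comp (f ∘ suc) g))
    horner f n = begin
      comp f g n
        ≈⟨ comp-pad f n (suc (suc n)) (ℕP.n≤1+n (suc n)) ⟩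
      sumTo (suc (suc n)) (λ k → f k * pow g k n)
        ≈⟨ sumTo-head (suc n) _ ⟩
      f 0 * one n + sumTo (suc n) (λ k → f (suc k) * sumTo (suc n) (λ j → g j * pow g k (n ∸ j)))
        ≈⟨ +-congˡ (sumTo-cong (suc n) (λ k → sumTo-*ˡ (suc n) _ _)) ⟨
      f 0 * one n + sumTo (suc n) (λ k → sumTo (suc n) (λ j → f (suc k) * (g j * pow g k (n ∸ j))))
        ≈⟨ +-congˡ (sumTo-swap (suc n) (suc n) _) ⟩
      f 0 * one n + sumTo (suc n) (λ j → sumTo (suc n) (λ k → f (suc k) * (g j * pow g k (n ∸ j))))
        ≈⟨ +-congˡ (sumTo-cong (suc n) (λ j → trans (sumTo-cong (suc n) (λ k → x∙yz≈y∙xz _ _ _))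
                                                     (sumTo-*ˡ (suc n) _ _))) ⟩
      f 0 * one n + sumTo (suc n) (λ j → g j * sumTo (suc n) (λ k → f (suc k) * pow g k (n ∸ j)))
        ≈⟨ +-congˡ (sumTo-cong (suc n) (λ j →
             *-congˡ (sym (comp-pad (f ∘ suc) (n ∸ j) (suc n) (s≤s (ℕP.m∸n≤m n j)))))) ⟩
      f 0 * one n + mul g (comp (f ∘ suc) g) n ∎
      where open import Algebra.Properties.CommutativeSemigroup *-commutativeSemigroup using (x∙yz≈y∙xz)

    -- Composition is multiplicative, coefficientwise below a bound n
    -- (by induction on n, using Horner's rule).
    comp-mul-below : ∀ n f h j → j < n → comp (mul f h) g j ≈ mul (comp f g) (comp h g) j
    comp-mul-below (suc n) f h j j<1+n = begin
      comp (mul f h) g j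
        ≈⟨ horner (mul f h) j ⟩
      add (const (mul f h 0)) (mul g (comp (mul f h ∘ suc) g)) j
        ≈⟨ +-cong constant-term (mul-agree-below g _ _ g₀≈0 j tail-below) ⟩
      add (mul f₀ h₀) (mul g (add (mul F′ (add h₀ (mul g H′))) (mul f₀ H′))) j
        ≈⟨ product-expansion f₀ h₀ g F′ H′ j ⟨
      mul (add f₀ (mul g F′)) (add h₀ (mul g H′)) j
        ≈⟨ mul-cong (horner f) (horner h) j ⟨
      mul (comp f g) (comp h g) j ∎
      where
      f₀ = const (f 0)
      h₀ = const (h 0)
      F′ = comp (f ∘ suc) g
      H′ = comp (h ∘ suc) g
      constant-term : const (mul f h 0) j ≈ mul f₀ h₀ j
      constant-term = trans (*-congʳ (+-identityˡ _))
                            (trans (*-assoc _ _ _) (sym (mul-const (f 0) h₀ j)))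
      tail-below : ∀ i → i < j →
        comp (mul f h ∘ suc) g i ≈ add (mul F′ (add h₀ (mul g H′))) (mul f₀ H′) i
      tail-below i i<j = begin
        comp (mul f h ∘ suc) g i
          ≈⟨ comp-cong (mul-tail f h) i ⟩
        comp (add (mul (f ∘ suc) h) (scale (f 0) (h ∘ suc))) g i
          ≈⟨ comp-add _ _ i ⟩
        comp (mul (f ∘ suc) h) g i + comp (scale (f 0) (h ∘ suc)) g i
          ≈⟨ +-cong (comp-mul-below n (f ∘ suc) h i (ℕP.<-≤-trans i<j (ℕP.≤-pred j<1+n)))
                    (comp-scale (f 0) (h ∘ suc) i) ⟩
        mul F′ (comp h g) i + f 0 * H′ i
          ≈⟨ +-cong (mul-cong {F′} (λ _ → refl) (horner h) i) (sym (mul-const (f 0) H′ i)) ⟩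
        add (mul F′ (add h₀ (mul g H′))) (mul f₀ H′) i ∎

    comp-mul : ∀ f h → comp (mul f h) g ≈ₛ mul (comp f g) (comp h g)
    comp-mul f h j = comp-mul-below (suc j) f h j ℕP.≤-refl

    quadratic-comp : ∀ C → C 0 ≈ 1# → (C ∘ suc) ≈ₛ mul C C →
                     comp C g ≈ₛ add one (mul g (mul (comp C g) (comp C g)))
    quadratic-comp C C₀≈1 C-shift n = trans (horner C n)
      (+-cong (trans (*-congʳ C₀≈1) (*-identityˡ _))
              (mul-cong {g} (λ _ → refl) (λ i → trans (comp-cong C-shift i) (comp-mul C C i)) n))

-- Segner numbers: the solution of  S₀ = 1,  S_{n+1} = Σ_{k≤n} S_k S_{n-k}.
module Segner where

  sumℕ : ℕ → (ℕ → ℕ) → ℕ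
  sumℕ zero    f = 0
  sumℕ (suc n) f = sumℕ n f ℕ.+ f n

  sumℕ-cong< : ∀ n {f g : ℕ → ℕ} → (∀ k → k < n → f k ≡ g k) → sumℕ n f ≡ sumℕ n g
  sumℕ-cong< zero    f≡g = ≡.refl
  sumℕ-cong< (suc n) f≡g =
    ≡.cong₂ ℕ._+_ (sumℕ-cong< n (λ k k<n → f≡g k (ℕP.m<n⇒m<1+n k<n))) (f≡g n ℕP.≤-refl)

  -- The recurrence unfolded with an explicit recursion depth.
  segnerUpTo : ℕ → ℕ → ℕ
  segnerUpTo zero       n       = 0
  segnerUpTo (suc fuel) zero    = 1
  segnerUpTo (suc fuel) (suc n) = sumℕ (suc n) (λ k → segnerUpTo fuel k ℕ.* segnerUpTo fuel (n ∸ k))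

  segnerUpTo-stable : ∀ d e n → n < d → n < e → segnerUpTo d n ≡ segnerUpTo e n
  segnerUpTo-stable (suc d) (suc e) zero    _         _         = ≡.refl
  segnerUpTo-stable (suc d) (suc e) (suc n) (s≤s n<d) (s≤s n<e) = sumℕ-cong< (suc n) (λ k k≤n →
    ≡.cong₂ ℕ._*_ (segnerUpTo-stable d e k (ℕP.<-≤-trans k≤n n<d) (ℕP.<-≤-trans k≤n n<e))
                  (segnerUpTo-stable d e (n ∸ k) (ℕP.≤-<-trans (ℕP.m∸n≤m n k) n<d)
                                                (ℕP.≤-<-trans (ℕP.m∸n≤m n k) n<e)))

  segner : ℕ → ℕ
  segner n = segnerUpTo (suc n) n

  segner-rec : ∀ n → segner (suc n) ≡ sumℕ (suc n) (λ k → segner k ℕ.* segner (n ∸ k))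
  segner-rec n = sumℕ-cong< (suc n) (λ k k<1+n →
    ≡.cong₂ ℕ._*_ (segnerUpTo-stable (suc n) (suc k) k k<1+n ℕP.≤-refl)
                  (segnerUpTo-stable (suc n) (suc (n ∸ k)) (n ∸ k) (s≤s (ℕP.m∸n≤m n k)) ℕP.≤-refl))

module SegnerSeries {c ℓ : Level} (R : CommutativeRing c ℓ) where
  open CommutativeRing R
  open Series R
  open FiniteSums R
  open NatEmbedding R
  open PowerSeries R
  open Segner
  open import Relation.Binary.Reasoning.Setoid setoid

  G : FPS
  G n = fromℕ (segner n)

  fromℕ-sum : ∀ n f → fromℕ (sumℕ n f) ≈ sumTo n (λ k → fromℕ (f k))
  fromℕ-sum zero    f = refl
  fromℕ-sum (suc n) f = trans (fromℕ-+ (sumℕ n f) (f n)) (+-congʳ (fromℕ-sum n f))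

  G-zero : G 0 ≈ 1#
  G-zero = +-identityʳ 1#

  G-shift : (G ∘ suc) ≈ₛ mul G G
  G-shift n = begin
    fromℕ (segner (suc n))                                   ≈⟨ reflexive (≡.cong fromℕ (segner-rec n)) ⟩
    fromℕ (sumℕ (suc n) (λ k → segner k ℕ.* segner (n ∸ k))) ≈⟨ fromℕ-sum (suc n) _ ⟩
    sumTo (suc n) (λ k → fromℕ (segner k ℕ.* segner (n ∸ k))) ≈⟨ sumTo-cong (suc n) (λ k → fromℕ-* (segner k) (segner (n ∸ k))) ⟩
    mul G G n                                                ∎

  G-equation : G ≈ₛ add one (mul X (mul G G))
  G-equation zero    = trans G-zero (sym (trans (+-congˡ (X-mul-zero (mul G G))) (+-identityʳ 1#)))
  G-equation (suc n) = trans (G-shift n) (sym (trans (+-identityˡ _) (X-mul-suc (mul G G) n)))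

  -- The Euler operator  θ = x d/dx :  [xⁿ] θf = n fₙ.  It is a derivation.
  θ : FPS → FPS
  θ f n = fromℕ n * f n

  θ-mul : ∀ f h → θ (mul f h) ≈ₛ add (mul (θ f) h) (mul f (θ h))
  θ-mul f h n = begin
    fromℕ n * sumTo (suc n) (λ k → f k * h (n ∸ k))
      ≈⟨ sumTo-*ˡ (suc n) _ _ ⟨
    sumTo (suc n) (λ k → fromℕ n * (f k * h (n ∸ k)))
      ≈⟨ sumTo-cong< (suc n) (λ k k<1+n → leibniz k (ℕP.≤-pred k<1+n)) ⟩
    sumTo (suc n) (λ k → (fromℕ k * f k) * h (n ∸ k) + f k * (fromℕ (n ∸ k) * h (n ∸ k)))
      ≈⟨ sumTo-+ (suc n) _ _ ⟩
    add (mul (θ f) h) (mul f (θ h)) n ∎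
    where
    open import Algebra.Properties.CommutativeSemigroup *-commutativeSemigroup using (x∙yz≈y∙xz)
    leibniz : ∀ k → k ≤ n → fromℕ n * (f k * h (n ∸ k)) ≈
              (fromℕ k * f k) * h (n ∸ k) + f k * (fromℕ (n ∸ k) * h (n ∸ k))
    leibniz k k≤n = begin
      fromℕ n * (f k * h (n ∸ k))
        ≈⟨ *-congʳ (reflexive (≡.cong fromℕ (≡.sym (ℕP.m+[n∸m]≡n k≤n)))) ⟩
      fromℕ (k ℕ.+ (n ∸ k)) * (f k * h (n ∸ k))
        ≈⟨ trans (*-congʳ (fromℕ-+ k (n ∸ k))) (distribʳ _ _ _) ⟩
      fromℕ k * (f k * h (n ∸ k)) + fromℕ (n ∸ k) * (f k * h (n ∸ k))
        ≈⟨ +-cong (sym (*-assoc _ _ _)) (x∙yz≈y∙xz _ _ _) ⟩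
      (fromℕ k * f k) * h (n ∸ k) + f k * (fromℕ (n ∸ k) * h (n ∸ k)) ∎

  -- Applying θ to  G = 1 + x G²  (θ1 = 0, θx = x).
  θG-equation : θ G ≈ₛ add (mul X (mul G G)) (mul X (add (mul (θ G) G) (mul G (θ G))))
  θG-equation n = begin
    θ G n
      ≈⟨ *-congˡ (G-equation n) ⟩
    fromℕ n * (one n + mul X (mul G G) n)
      ≈⟨ distribˡ _ _ _ ⟩
    fromℕ n * one n + θ (mul X (mul G G)) n
      ≈⟨ +-cong (θ-one n) (θ-mul X (mul G G) n) ⟩
    0# + add (mul (θ X) (mul G G)) (mul X (θ (mul G G))) n
      ≈⟨ trans (+-identityˡ _) (+-cong (mul-cong {g = mul G G} θ-X (λ _ → refl) n)
                                       (mul-cong {X} (λ _ → refl) (θ-mul G G) n)) ⟩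
    add (mul X (mul G G)) (mul X (add (mul (θ G) G) (mul G (θ G)))) n ∎
    where
    θ-one : ∀ n → fromℕ n * one n ≈ 0#
    θ-one zero    = zeroˡ _
    θ-one (suc n) = zeroʳ _
    θ-X : θ X ≈ₛ X
    θ-X zero          = zeroˡ _
    θ-X (suc zero)    = trans (*-identityʳ _) (+-identityʳ _)
    θ-X (suc (suc n)) = zeroʳ _

  -- Coefficient n+1 of  (1 - 4x) θG + G = 1 + 2x G.
  segner-ratio-coeff : ∀ n → fromℕ (suc n) * G (suc n) + G (suc n) ≈
                             (G n + G n) + ((θ G n + θ G n) + (θ G n + θ G n))
  segner-ratio-coeff n = begin
    fromℕ (suc n) * G (suc n) + G (suc n)
      ≈⟨ quadratic-ratio X G (θ G) G-equation θG-equation (suc n) ⟩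
    0# + ((XG + XG) + ((XQ + XQ) + (XQ + XQ)))
      ≈⟨ +-identityˡ _ ⟩
    (XG + XG) + ((XQ + XQ) + (XQ + XQ))
      ≈⟨ +-cong (+-cong G′ G′) (+-cong (+-cong Q′ Q′) (+-cong Q′ Q′)) ⟩
    (G n + G n) + ((θ G n + θ G n) + (θ G n + θ G n)) ∎
    where
    open RingIdentities powerSeriesRing using (quadratic-ratio)
    XG = mul X G (suc n)
    XQ = mul X (θ G) (suc n)
    G′ = X-mul-suc G n
    Q′ = X-mul-suc (θ G) n

module SegnerIsCatalan where
  open Segner
  open import Data.Nat using (_*_; _+_; _!)
  open import Data.Nat.Combinatorics using (_C_; k![n∸k]!∣n!)
  open import Data.Nat.Combinatorics.Specification using (nCk≡n!/k![n-k]!)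
  open import Data.Nat.DivMod using (_/_; m/n*n≡m; m*n/n≡m)
  open import Data.Integer using (+_) renaming (_+_ to _+ℤ_; _*_ to _*ℤ_)
  import Data.Integer.Properties as ℤP
  open import Data.Nat.Solver using (module +-*-Solver)
  open +-*-Solver
  open ≡.≡-Reasoning

  private
    module ℤSegner = SegnerSeries ℤP.+-*-commutativeRing
    module ℤSeries = Series ℤP.+-*-commutativeRing
    module ℤEmbedding = NatEmbedding ℤP.+-*-commutativeRing

  -- In ℤ the embedding  ℕ → R  is the constructor  +_ ,  hence injective.
  ℤ-fromℕ : ∀ k → ℤSeries.fromℕ k ≡ + k
  ℤ-fromℕ zero    = ≡.refl
  ℤ-fromℕ (suc k) = ≡.cong (+ 1 +ℤ_) (ℤ-fromℕ k)

  -- (n+2) S_{n+1} = 2(2n+1) S_n,  read off from  segner-ratio-coeff  in ℤ.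
  segner-ratio : ∀ n → (2 + n) * segner (suc n) ≡ 2 * (1 + 2 * n) * segner n
  segner-ratio n = begin
    (2 + n) * S′                          ≡⟨ solve 2 (λ n S′ → (con 2 :+ n) :* S′ := (con 1 :+ n) :* S′ :+ S′) ≡.refl n S′ ⟩
    suc n * S′ + S′                       ≡⟨ ℤP.+-injective in-ℤ ⟩
    (S + S) + ((n * S + n * S) + (n * S + n * S))
      ≡⟨ solve 2 (λ n S → (S :+ S) :+ ((n :* S :+ n :* S) :+ (n :* S :+ n :* S))
                          := con 2 :* (con 1 :+ con 2 :* n) :* S) ≡.refl n S ⟩
    2 * (1 + 2 * n) * S                   ∎
    where
    S = segner n
    S′ = segner (suc n)
    open ℤSeries using (fromℕ)
    open ℤEmbedding
    open ℤSegner using (G; θ; segner-ratio-coeff)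
    nS = n * S
    in-ℤ : + (suc n * S′ + S′) ≡ + ((S + S) + ((nS + nS) + (nS + nS)))
    in-ℤ = begin
      + (suc n * S′ + S′)
        ≡⟨ ℤ-fromℕ _ ⟨
      fromℕ (suc n * S′ + S′)
        ≡⟨ ≡.trans (fromℕ-+ (suc n * S′) S′) (≡.cong (_+ℤ G (suc n)) (fromℕ-* (suc n) S′)) ⟩
      fromℕ (suc n) *ℤ G (suc n) +ℤ G (suc n)
        ≡⟨ segner-ratio-coeff n ⟩
      (G n +ℤ G n) +ℤ ((θ G n +ℤ θ G n) +ℤ (θ G n +ℤ θ G n))
        ≡⟨ ≡.cong (λ q → (G n +ℤ G n) +ℤ ((q +ℤ q) +ℤ (q +ℤ q))) (fromℕ-* n S) ⟨
      (G n +ℤ G n) +ℤ ((fromℕ nS +ℤ fromℕ nS) +ℤ (fromℕ nS +ℤ fromℕ nS))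
        ≡⟨ ≡.cong₂ _+ℤ_ (fromℕ-+ S S) (≡.cong₂ _+ℤ_ (fromℕ-+ nS nS) (fromℕ-+ nS nS)) ⟨
      fromℕ (S + S) +ℤ (fromℕ (nS + nS) +ℤ fromℕ (nS + nS))
        ≡⟨ ≡.cong (fromℕ (S + S) +ℤ_) (fromℕ-+ (nS + nS) (nS + nS)) ⟨
      fromℕ (S + S) +ℤ fromℕ ((nS + nS) + (nS + nS))
        ≡⟨ fromℕ-+ (S + S) _ ⟨
      fromℕ ((S + S) + ((nS + nS) + (nS + nS)))
        ≡⟨ ℤ-fromℕ _ ⟩
      + ((S + S) + ((nS + nS) + (nS + nS))) ∎

  central : ℕ → ℕ
  central n = (2 * n) C n

  binomial-factorials : ∀ {n k} → k ≤ n → (n C k) * (k ! * (n ∸ k) !) ≡ n !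
  binomial-factorials {n} {k} k≤n = begin
    (n C k) * (k ! * (n ∸ k) !)
      ≡⟨ ≡.cong (_* (k ! * (n ∸ k) !)) (nCk≡n!/k![n-k]! k≤n) ⟩
    (n ! / (k ! * (n ∸ k) !)) {{k !* (n ∸ k) !≢0}} * (k ! * (n ∸ k) !)
      ≡⟨ m/n*n≡m {{k !* (n ∸ k) !≢0}} (k![n∸k]!∣n! k≤n) ⟩
    n ! ∎
    where open ℕP using (_!*_!≢0)

  central-factorials : ∀ n → central n * (n ! * n !) ≡ (2 * n) !
  central-factorials n =
    ≡.subst (λ t → central n * (n ! * t !) ≡ (2 * n) !) 2n∸n≡n
            (binomial-factorials (ℕP.m≤m+n n (n + 0)))
    where
    2n∸n≡n : 2 * n ∸ n ≡ n
    2n∸n≡n = ≡.trans (ℕP.m+n∸m≡n n (n + 0)) (ℕP.+-identityʳ n)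

  central-ratio : ∀ n → (1 + n) * central (suc n) ≡ 2 * (1 + 2 * n) * central n
  central-ratio n = ℕP.*-cancelʳ-≡ _ _ ((1 + n) * (n ! * n !)) {{nonZero}} (begin
    (1 + n) * B′ * ((1 + n) * (n ! * n !))
      ≡⟨ solve 3 (λ n B′ F → ((con 1 :+ n) :* B′) :* ((con 1 :+ n) :* (F :* F))
                             := B′ :* (((con 1 :+ n) :* F) :* ((con 1 :+ n) :* F))) ≡.refl n B′ (n !) ⟩
    B′ * (suc n ! * suc n !)
      ≡⟨ central-factorials (suc n) ⟩
    (2 * suc n) !
      ≡⟨ ≡.cong _! (ℕP.*-suc 2 n) ⟩
    (2 + 2 * n) * ((1 + 2 * n) * (2 * n) !)
      ≡⟨ ≡.cong (λ t → (2 + 2 * n) * ((1 + 2 * n) * t)) (central-factorials n) ⟨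
    (2 + 2 * n) * ((1 + 2 * n) * (central n * (n ! * n !)))
      ≡⟨ solve 3 (λ n B F → (con 2 :+ con 2 :* n) :* ((con 1 :+ con 2 :* n) :* (B :* (F :* F)))
                            := ((con 2 :* (con 1 :+ con 2 :* n)) :* B) :* ((con 1 :+ n) :* (F :* F)))
                 ≡.refl n (central n) (n !) ⟩
    2 * (1 + 2 * n) * central n * ((1 + n) * (n ! * n !)) ∎)
    where
    B′ = central (suc n)
    nonZero : ℕ.NonZero ((1 + n) * (n ! * n !))
    nonZero = ℕP.m*n≢0 (1 + n) (n ! * n !) {{_}} {{ℕP._!*_!≢0 n n}}

  -- Both sequences start at 1 and satisfy the same first-order recurrence.
  segner-central : ∀ n → suc n * segner n ≡ central n
  segner-central zero    = ≡.refl
  segner-central (suc n) = ℕP.*-cancelʳ-≡ _ _ (suc n) (begin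
    (2 + n) * S′ * (1 + n)                ≡⟨ ≡.cong (_* (1 + n)) (segner-ratio n) ⟩
    2 * (1 + 2 * n) * segner n * (1 + n)  ≡⟨ solve 3 (λ a S n → a :* S :* (con 1 :+ n) := a :* ((con 1 :+ n) :* S))
                                                    ≡.refl (2 * (1 + 2 * n)) (segner n) n ⟩
    2 * (1 + 2 * n) * (suc n * segner n)  ≡⟨ ≡.cong (2 * (1 + 2 * n) *_) (segner-central n) ⟩
    2 * (1 + 2 * n) * central n           ≡⟨ central-ratio n ⟨
    (1 + n) * central (suc n)             ≡⟨ ℕP.*-comm (1 + n) _ ⟩
    central (suc n) * (1 + n)             ∎)
    where S′ = segner (suc n)

  catalan≡segner : ∀ n → catalan n ≡ segner n
  catalan≡segner n = begin
    central n / suc n            ≡⟨ ≡.cong (_/ suc n) (segner-central n) ⟨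
    suc n * segner n / suc n     ≡⟨ ≡.cong (_/ suc n) (ℕP.*-comm (suc n) (segner n)) ⟩
    segner n * suc n / suc n     ≡⟨ m*n/n≡m (segner n) (suc n) ⟩
    segner n                     ∎

module CatalanSeries {c ℓ : Level} (R : CommutativeRing c ℓ) where
  open CommutativeRing R
  open Series R
  open PowerSeries R
  open SegnerSeries R using (G; G-zero; G-shift)
  open SegnerIsCatalan using (catalan≡segner)

  catalan≈G : catalanGF ≈ₛ G
  catalan≈G n = reflexive (≡.cong fromℕ (catalan≡segner n))

  catalan-zero : catalanGF 0 ≈ 1#
  catalan-zero = trans (catalan≈G 0) G-zero

  catalan-shift : (catalanGF ∘ suc) ≈ₛ mul catalanGF catalanGF
  catalan-shift n = trans (catalan≈G (suc n))
    (trans (G-shift n) (sym (mul-cong catalan≈G catalan≈G n)))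

module Recurrence {c ℓ : Level} (R : CommutativeRing c ℓ) (a b m : CommutativeRing.Carrier R) where
  open CommutativeRing R
  open Series R
  open FiniteSums R using (sumTo-cong<)
  open PowerSeries R
  open RingIdentities R using (solve-first; solve-step)
  open import Data.Nat.Induction using (<-rec)
  open import Relation.Binary.Reasoning.Setoid setoid

  next : (ℕ → Carrier) → ℕ → Carrier
  next s n = ((- b) + fromℕ 2 * m) * s (suc n) + m * sumTo n (λ k → s (suc k) * s (n ∸ k))

  next-cong : ∀ {s t} n → (∀ {i} → i < suc (suc n) → s i ≈ t i) → next s n ≈ next t n
  next-cong n s≈t = +-cong (*-congˡ (s≈t ℕP.≤-refl)) (*-congˡ (sumTo-cong< n (λ k k<n →
    *-cong (s≈t (s≤s (ℕP.m<n⇒m<1+n k<n))) (s≈t (s≤s (ℕP.m≤n⇒m≤1+n (ℕP.m∸n≤m n k)))))))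

  recurrence-unique : ∀ s t → s 0 ≈ t 0 → s 1 ≈ t 1 →
    (∀ n → s (suc (suc n)) ≈ next s n) → (∀ n → t (suc (suc n)) ≈ next t n) →
    ∀ n → s n ≈ t n
  recurrence-unique s t s₀≈t₀ s₁≈t₁ s-rec t-rec = <-rec (λ j → s j ≈ t j) step
    where
    step : ∀ j → (∀ {i} → i < j → s i ≈ t i) → s j ≈ t j
    step zero          _     = s₀≈t₀
    step (suc zero)    _     = s₁≈t₁
    step (suc (suc n)) below = trans (s-rec n) (trans (next-cong n below) (sym (t-rec n)))

  -- Reading  (1 + bx) F = (1 + ax) + m x F²  coefficientwise gives the recurrence.
  module _ (F : FPS)
           (F-equation : mul (onePlus b) F ≈ₛ add (onePlus a) (scale m (mul X (mul F F)))) where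

    F-zero : F 0 ≈ 1#
    F-zero = begin
      F 0                         ≈⟨ onePlus-mul-zero b F ⟨
      mul (onePlus b) F 0         ≈⟨ F-equation 0 ⟩
      1# + m * mul X (mul F F) 0  ≈⟨ +-congˡ (trans (*-congˡ (X-mul-zero (mul F F))) (zeroʳ m)) ⟩
      1# + 0#                     ≈⟨ +-identityʳ 1# ⟩
      1#                          ∎

    F-one : F 1 ≈ a - b + m
    F-one = solve-first a b m (begin
      F 1 + b                     ≈⟨ +-congˡ (trans (*-congˡ F-zero) (*-identityʳ b)) ⟨
      F 1 + b * F 0               ≈⟨ onePlus-mul-suc b F 0 ⟨
      mul (onePlus b) F 1         ≈⟨ F-equation 1 ⟩
      a + m * mul X (mul F F) 1   ≈⟨ +-congˡ (*-congˡ (X-mul-suc (mul F F) 0)) ⟩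
      a + m * (0# + F 0 * F 0)    ≈⟨ +-congˡ (*-congˡ (trans (+-identityˡ _) (trans (*-cong F-zero F-zero) (*-identityʳ 1#)))) ⟩
      a + m * 1#                  ≈⟨ +-congˡ (*-identityʳ m) ⟩
      a + m                       ∎)

    F-rec : ∀ n → F (suc (suc n)) ≈ next F n
    F-rec n = solve-step b m y S (begin
      F (suc (suc n)) + b * y                          ≈⟨ onePlus-mul-suc b F (suc n) ⟨
      mul (onePlus b) F (suc (suc n))                  ≈⟨ F-equation (suc (suc n)) ⟩
      0# + m * mul X (mul F F) (suc (suc n))           ≈⟨ +-identityˡ _ ⟩
      m * mul X (mul F F) (suc (suc n))                ≈⟨ *-congˡ (X-mul-suc (mul F F) (suc n)) ⟩
      m * mul F F (suc n)                              ≈⟨ *-congˡ (square-suc F n) ⟩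
      m * (F 0 * y + (S + y * F 0))                    ≈⟨ *-congˡ (+-cong (trans (*-congʳ F-zero) (*-identityˡ y))
                                                                 (+-congˡ (trans (*-congˡ F-zero) (*-identityʳ y)))) ⟩
      m * (y + (S + y))                                ∎)
      where
      y = F (suc n)
      S = sumTo n (λ k → F (suc k) * F (n ∸ k))

  -- The series of the theorem satisfies that equation:  with  A = 1 + ax,
  -- I = (1 + bx)⁻¹,  g = m x A I²  and  C = c(g) = 1 + g C²,  F = A I C.
  theSeries-equation : mul (onePlus b) (theSeries a b m) ≈ₛ
                       add (onePlus a) (scale m (mul X (mul (theSeries a b m) (theSeries a b m))))
  theSeries-equation n = trans
    (functional-equation (onePlus a) (onePlus b) I C g (const m) X
                         (onePlus-inverse b) C-equation (λ k → sym (mul-const m (mul X (mul (onePlus a) (mul I I))) k)) n)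
    (+-congˡ (mul-const m (mul X (mul F F)) n))
    where
    open RingIdentities powerSeriesRing using (functional-equation)
    open CatalanSeries R using (catalan-zero; catalan-shift)
    F = theSeries a b m
    I = invOnePlus b
    g = scale m (mul X (mul (onePlus a) (mul I I)))
    g₀≈0 : g 0 ≈ 0#
    g₀≈0 = trans (*-congˡ (X-mul-zero (mul (onePlus a) (mul I I)))) (zeroʳ m)
    C = comp catalanGF g
    C-equation : C ≈ₛ add one (mul g (mul C C))
    C-equation = Composition.quadratic-comp R g g₀≈0 catalanGF catalan-zero catalan-shift


-- Main theorem: the series is the generating function of the recursively
-- defined sequence.
mainTheorem4 : ∀ {c ℓ : Level} (R : CommutativeRing c ℓ) →
    let open CommutativeRing R
        open Series R
    in ∀ (a b m : Carrier) → ¬ (m ≈ 0#) →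
       ∀ (s : ℕ → Carrier) →
       s 0 ≈ 1# →
       s 1 ≈ a - b + m →
       (∀ n → s (suc (suc n)) ≈
          ((- b) + fromℕ 2 * m) * s (suc n)
            + m * sumTo n (λ k → s (suc k) * s (n ∸ k))) →
       ∀ n → theSeries a b m n ≈ s n
mainTheorem4 R a b m _ s s₀ s₁ s-rec =
  recurrence-unique F s (trans (F-zero F theSeries-equation) (sym s₀))
                        (trans (F-one F theSeries-equation) (sym s₁))
                        (F-rec F theSeries-equation) s-rec
  where
  open CommutativeRing R using (trans; sym)
  open Recurrence R a b m
  F = Series.theSeries R a b m
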